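{- Let $S$ be a variable preserving term equation system over a ranked alphabet $\Sigma$, let $p,q\in T_\Sigma$, and let $W_i,P_i,Q_i$ ($i\ge1$) be the ground term equation systems defined in the context. If $W_i=W_{i+1}$ for some $i\ge1$, then $W_i=W_{i+j}$ for all $j\ge0$. If $P_i=P_{i+1}$ for some $i\ge1$, then $P_i=P_{i+j}$ for all $j\ge0$. If $Q_i=Q_{i+1}$ for some $i\ge1$, then $Q_i=Q_{i+j}$ for all $j\ge0$.
   Context: Notation. $\Sigma$ is a ranked alphabet ($\Sigma_m$: symbols of rank $m$), $T_\Sigma$ the ground terms, $X_m=\{x_1,\dots,x_m\}$, $T_\Sigma(X_m)$ terms with variables in $X_m$; $t[t_1,\dots,t_m]$ replaces each $x_j$ by $t_j$. A context is a term $u\in T_\Sigma(X_1)$ with exactly one occurrence of $x_1$; $u[s]$ replaces $x_1$ by $s$. A TES $S$ is a finite set of equations $l\approx r$ of terms; it is variable preserving if $l$ and $r$ contain the same variables in each equation, which is then written with $l,r\in T_\Sigma(X_m)$. A ground term equation system (GTES) $E$ is a finite set of equations between ground terms; $\Leftrightarrow^*_E$ is the congruence on $T_\Sigma$ generated by $E$. Congruence class computing tree automaton associated with a GTES $E$ and ground terms $p,q$: $T$ is the set of all subterms of $p$, $q$ and of both sides of all equations of $E$; $\Theta=\Leftrightarrow^*_E\cap(T\times T)$ with classes $[t]_\Theta$; states $A=\{[t]_\Theta:t\in T\}$ (new constants); rules $R=\{f([t_1]_\Theta,\dots,[t_m]_\Theta)\to[f(t_1,\dots,t_m)]_\Theta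 : f(t_1,\dots,t_m)\in T\}$; $\to^*_R$ is rewriting with $R$ on terms over $\Sigma\cup A$. For each $a\in A$ a ground term $tree(a)\in T_\Sigma$ with $tree(a)\to^*_R a$ is fixed (computed by a fixed deterministic effective algorithm, so it depends only on the automaton). The automaton reaches $b$ starting from $c$ if $u[c]\to^*_R b$ for some context $u$ ($u=x_1$ allowed). $W_1$ is the set of ground equations $l[u_1,\dots,u_m]\approx r[u_1,\dots,u_m]$ ($l\approx r\in S$, $u_j\in T_\Sigma$) such that $l[u_1,\dots,u_m]$ or $r[u_1,\dots,u_m]$ is a subterm of $p$ or of $q$. With $A_i,R_i,\Theta_i,tree_i$ the data of the automaton associated with $W_i$ and $p,q$, $W_{i+1}$ consists of $W_i$ together with every equation $l[tree_i(a_1),\dots,tree_i(a_m)]\approx r[tree_i(a_1),\dots,tree_i(a_m)]$ with $l\approx r\in S$, $a_1,\dots,a_m,a\in A_i$ such that (1) $l[a_1,\dots,a_m]\to^*_{R_i}a$ or $r[a_1,\dots,a_m]\to^*_{R_i}a$, (2) the automaton reaches $[p]_{\Theta_i}$ or $[q]_{\Theta_i}$ starting from $a$, (3) the pair of the two sides is not in $\Leftrightarrow^*_{W_i}$. $P_i$ is defined in the same way with only $p$: in $P_1$ the instantiated side must be a subterm of $p$; for $P_{i+1}$ the automaton is the one associated with $P_i$ and $p,q$, (2) reads "reaches $[p]_{\Theta_i}$ from $a$", and (3) uses $\Leftrightarrow^*_{P_i}$. $Q_i$ is defined symmetrically with $q$ in place of $p$. -}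

module Defs where

open import Level using (0ℓ)
open import Data.Nat using (ℕ; zero; suc; _+_)
open import Data.Fin using (Fin)
open import Data.Empty using (⊥; ⊥-elim)
open import Data.Unit using (⊤)
open import Data.Sum using (_⊎_)
open import Data.Product using (Σ; ∃; ∃-syntax; _×_; _,_)
open import Data.List using (List)
open import Data.List.Membership.Propositional using (_∈_)
open import Data.List.Relation.Unary.All using (All)
open import Data.Vec using (Vec; []; _∷_; lookup; _[_]≔_; map)
open import Data.Vec.Relation.Unary.Any using (Any)
open import Data.Vec.Relation.Binary.Pointwise.Inductive using (Pointwise)
open import Relation.Binary.PropositionalEquality using (_≡_)
open import Relation.Binary.Construct.Closure.ReflexiveTransitive using (Star)
open import Relation.Nullary using (¬_)
open import Relation.Unary using (Pred)
open import Function using (_∘_; _⇔_)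

record RankedAlphabet : Set₁ where
  field
    Sym : Set
    ar  : Sym → ℕ

module _ (Sg : RankedAlphabet) where
  open RankedAlphabet Sg

  -- Terms over Σ with variables (or extra constant leaves) from V.
  data Tm (V : Set) : Set where
    var : V → Tm V
    app : (f : Sym) → Vec (Tm V) (ar f) → Tm V

  GTm : Set
  GTm = Tm ⊥

  mutual
    _⟪_⟫ : ∀ {V W} → Tm V → (V → Tm W) → Tm W
    var x ⟪ σ ⟫ = σ x
    app f ts ⟪ σ ⟫ = app f (substs ts σ)

    substs : ∀ {V W n} → Vec (Tm V) n → (V → Tm W) → Vec (Tm W) n
    substs [] σ = []
    substs (t ∷ ts) σ = (t ⟪ σ ⟫) ∷ substs ts σ

  mutual
    occ : ∀ {V} → Tm V → ℕ
    occ (var x) = 1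
    occ (app f ts) = occs ts

    occs : ∀ {V n} → Vec (Tm V) n → ℕ
    occs [] = 0
    occs (t ∷ ts) = occ t + occs ts

  data _∈v_ {V : Set} (x : V) : Tm V → Set where
    here  : x ∈v var x
    there : ∀ {f ts} → Any (x ∈v_) ts → x ∈v app f ts

  data _⊑_ {V : Set} (s : Tm V) : Tm V → Set where
    refl⊑ : s ⊑ s
    sub   : ∀ {f ts} → Any (s ⊑_) ts → s ⊑ app f ts

  TES : Set
  TES = List (Σ ℕ λ m → Tm (Fin m) × Tm (Fin m))

  VarPreserving : TES → Set
  VarPreserving S =
    All (λ { (m , l , r) → (x : Fin m) → (x ∈v l) ⇔ (x ∈v r) }) S

  GTES : Set₁
  GTES = Pred (GTm × GTm) 0ℓ

  data Cong (E : GTES) : GTm → GTm → Set where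
    base  : ∀ {s t} → E (s , t) → Cong E s t
    refl  : ∀ {t} → Cong E t t
    sym   : ∀ {s t} → Cong E s t → Cong E t s
    trans : ∀ {s t u} → Cong E s t → Cong E t u → Cong E s u
    cong  : ∀ f {ss ts} → Pointwise (Cong E) ss ts → Cong E (app f ss) (app f ts)

  ⌜_⌝ : ∀ {A} → GTm → Tm A
  ⌜ t ⌝ = t ⟪ ⊥-elim ⟫

  module Automaton (p q : GTm) (E : GTES) where
    InT : GTm → Set
    InT t = t ⊑ p ⊎ t ⊑ q ⊎ (∃[ l ] ∃[ r ] (E (l , r) × (t ⊑ l ⊎ t ⊑ r)))

    -- Θ = ⇔*_E ∩ (T × T).  A state [t]_Θ is represented by any t ∈ T;
    -- two representatives denote the same state iff they are Θ-related.
    Θ : GTm → GTm → Set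
    Θ s t = InT s × InT t × Cong E s t

    -- One rewrite step with R on terms over Σ ∪ A (states as leaves):
    -- f([t₁],…,[tₘ]) → [f(t₁,…,tₘ)]  for f(t₁,…,tₘ) ∈ T, applied in any context.
    data Step : Tm GTm → Tm GTm → Set where
      rule : ∀ f (ts : Vec GTm (ar f)) (cs : Vec GTm (ar f)) (d : GTm) →
             InT (app f ts) → Pointwise Θ cs ts → Θ d (app f ts) →
             Step (app f (map var cs)) (var d)
      inside : ∀ f (us : Vec (Tm GTm) (ar f)) (i : Fin (ar f)) (v : Tm GTm) →
               Step (lookup us i) v → Step (app f us) (app f (us [ i ]≔ v))

    _⇒*_ : Tm GTm → GTm → Set
    t ⇒* a = ∃[ d ] (Star Step t (var d) × Θ d a)

    Reaches : GTm → GTm → Set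
    Reaches c b = ∃[ u ] (occ {⊤} u ≡ 1 × ((u ⟪ (λ _ → var c) ⟫) ⇒* b))

  -- A procedure choosing tree(a) for every state a of the automaton
  -- associated with a GTES E (and p , q).
  TreeAlg : Set₁
  TreeAlg = GTES → GTm → GTm

  -- Requirements: tree(a) →*_R a; tree is a function of the state (class);
  -- and it depends only on the automaton (i.e. on T and Θ).
  ValidTreeAlg : (p q : GTm) → TreeAlg → Set₁
  ValidTreeAlg p q tree =
    (∀ E t → Automaton.InT p q E t → Automaton._⇒*_ p q E ⌜ tree E t ⌝ t)
    × (∀ E s t → Automaton.Θ p q E s t → tree E s ≡ tree E t)
    × (∀ E E' → (∀ t → Automaton.InT p q E t ⇔ Automaton.InT p q E' t)
              → (∀ s t → Automaton.Θ p q E s t ⇔ Automaton.Θ p q E' s t)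
              → ∀ t → Automaton.InT p q E t → tree E t ≡ tree E' t)

  -- The sequences W_i / P_i / Q_i, parameterised by the target set
  -- ({p , q}, {p} or {q} respectively).
  module Sequence (S : TES) (p q : GTm) (tree : TreeAlg) (Tgt : GTm → Set) where

    first : GTES
    first (L , R) =
      ∃[ e ] (e ∈ S × (let (m , l , r) = e in
        ∃[ us ] (L ≡ (l ⟪ us ⟫) × R ≡ (r ⟪ us ⟫)
                 × ∃[ x ] (Tgt x × (L ⊑ x ⊎ R ⊑ x)))))

    next : GTES → GTES
    next E (L , R) = E (L , R) ⊎
      ∃[ e ] (e ∈ S × (let (m , l , r) = e in
        ∃[ as ] ∃[ a ]
          ((∀ j → InT (as j)) × InT a
          × ((l ⟪ var ∘ as ⟫) ⇒* a ⊎ (r ⟪ var ∘ as ⟫) ⇒* a)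
          × (∃[ x ] (Tgt x × Reaches a x))
          × ¬ Cong E (l ⟪ tree E ∘ as ⟫) (r ⟪ tree E ∘ as ⟫)
          × L ≡ (l ⟪ tree E ∘ as ⟫) × R ≡ (r ⟪ tree E ∘ as ⟫))))
      where open Automaton p q E

    -- seq i = the i-th system (meaningful for i ≥ 1; seq 0 is a dummy copy of seq 1)
    seq : ℕ → GTES
    seq zero = first
    seq (suc zero) = first
    seq (suc (suc n)) = next (seq (suc n))

  W : TES → (p q : GTm) → TreeAlg → ℕ → GTES
  W S p q tree = Sequence.seq S p q tree (λ x → x ≡ p ⊎ x ≡ q)

  P : TES → (p q : GTm) → TreeAlg → ℕ → GTES
  P S p q tree = Sequence.seq S p q tree (λ x → x ≡ p)

  Q : TES → (p q : GTm) → TreeAlg → ℕ → GTES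
  Q S p q tree = Sequence.seq S p q tree (λ x → x ≡ q)

-- Each of the three sequences is obtained by iterating one operator
-- `next` (Defs, module Sequence) from its first member, and `next E`
-- depends on E only through the set of equations E denotes: the
-- automaton built from E (its set T, its relation Θ, its rewrite steps)
-- is monotone in E, the chosen trees tree(a) depend only on the
-- automaton, and the negative side condition ¬ (l ⇔*_E r) is
-- antitone in E.  Hence `next` maps equal sets of equations (_≐_) to
-- equal sets of equations.  The theorem then follows from a general
-- fact about iterating any ≐-respecting operator: once two consecutive
-- members agree, all later members agree with them as well.
module Submission where

open import Defs
open import Data.Nat using (ℕ; suc; _+_; _≤_)
open import Data.Product using (_×_)
open import Relation.Unary using (_≐_)

open import Level using (Level)
open import Data.Nat using (zero; s≤s; z≤n)
open import Data.Nat.Properties using (+-identityʳ; +-suc)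
open import Data.Product using (_,_; proj₂)
open import Data.Sum using (inj₁; inj₂)
import Data.Sum as Sum
open import Data.Vec using (Vec; []; _∷_)
open import Data.Vec.Relation.Binary.Pointwise.Inductive as Pointwise
  using (Pointwise; []; _∷_)
import Relation.Binary.Construct.Closure.ReflexiveTransitive as Star
open import Relation.Binary.PropositionalEquality as ≡ using (_≡_)
open import Relation.Unary using (Pred; _⊆_)
open import Relation.Unary.Properties using (≐-refl; ≐-sym; ≐-trans)
open import Function using (_∘_)
open import Relation.Nullary using (¬_)
open import Function.Bundles using (mk⇔)

module Iteration {a ℓ : Level} {A : Set a}
  (F : Pred A ℓ → Pred A ℓ) (F-resp : ∀ {X Y} → X ≐ Y → F X ≐ F Y)
  (t : ℕ → Pred A ℓ) (t-step : ∀ n → t (suc n) ≐ F (t n)) where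

  repetition-propagates : ∀ k → t k ≐ t (suc k) → t (suc k) ≐ t (suc (suc k))
  repetition-propagates k rep =
    ≐-trans (t-step k) (≐-trans (F-resp rep) (≐-sym (t-step (suc k))))

  stable-from : ∀ k → t k ≐ t (suc k) → ∀ j → t k ≐ t (k + j)
  stable-from k rep zero rewrite +-identityʳ k = ≐-refl
  stable-from k rep (suc j) rewrite +-suc k j =
    ≐-trans rep (stable-from (suc k) (repetition-propagates k rep) j)

module _ (Sg : RankedAlphabet) where

  mutual
    cong-mono : ∀ {E E' : GTES Sg} → E ⊆ E' →
                ∀ {s t} → Cong Sg E s t → Cong Sg E' s t
    cong-mono E⊆E' (base e) = base (E⊆E' e)
    cong-mono E⊆E' refl = refl
    cong-mono E⊆E' (sym c) = sym (cong-mono E⊆E' c)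
    cong-mono E⊆E' (trans c d) = trans (cong-mono E⊆E' c) (cong-mono E⊆E' d)
    cong-mono E⊆E' (cong f cs) = cong f (pointwise-cong-mono E⊆E' cs)

    pointwise-cong-mono : ∀ {E E' : GTES Sg} → E ⊆ E' →
                          ∀ {n} {ss ts : Vec (GTm Sg) n} →
                          Pointwise (Cong Sg E) ss ts → Pointwise (Cong Sg E') ss ts
    pointwise-cong-mono E⊆E' [] = []
    pointwise-cong-mono E⊆E' (c ∷ cs) = cong-mono E⊆E' c ∷ pointwise-cong-mono E⊆E' cs

  mutual
    subst-ext : ∀ {V W} (t : Tm Sg V) {σ τ : V → Tm Sg W} →
                (∀ x → σ x ≡ τ x) → _⟪_⟫ Sg t σ ≡ _⟪_⟫ Sg t τ
    subst-ext (var x) σ≗τ = σ≗τ x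
    subst-ext (app f ts) σ≗τ = ≡.cong (app f) (substs-ext ts σ≗τ)

    substs-ext : ∀ {V W n} (ts : Vec (Tm Sg V) n) {σ τ : V → Tm Sg W} →
                 (∀ x → σ x ≡ τ x) → substs Sg ts σ ≡ substs Sg ts τ
    substs-ext [] σ≗τ = ≡.refl
    substs-ext (t ∷ ts) σ≗τ = ≡.cong₂ _∷_ (subst-ext t σ≗τ) (substs-ext ts σ≗τ)

  module AutomatonMonotone (p q : GTm Sg) {E E' : GTES Sg} (E⊆E' : E ⊆ E') where
    open Automaton Sg p q

    inT-mono : ∀ {t} → InT E t → InT E' t
    inT-mono (inj₁ t⊑p) = inj₁ t⊑p
    inT-mono (inj₂ (inj₁ t⊑q)) = inj₂ (inj₁ t⊑q)
    inT-mono (inj₂ (inj₂ (l , r , lr∈E , t⊑lr))) = inj₂ (inj₂ (l , r , E⊆E' lr∈E , t⊑lr))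

    Θ-mono : ∀ {s t} → Θ E s t → Θ E' s t
    Θ-mono (s∈T , t∈T , s⇔t) = inT-mono s∈T , inT-mono t∈T , cong-mono E⊆E' s⇔t

    step-mono : ∀ {u v} → Step E u v → Step E' u v
    step-mono (rule f ts cs d f∈T cs≈ts d≈f) =
      rule f ts cs d (inT-mono f∈T) (Pointwise.map Θ-mono cs≈ts) (Θ-mono d≈f)
    step-mono (inside f us i v st) = inside f us i v (step-mono st)

    run-mono : ∀ {u a} → _⇒*_ E u a → _⇒*_ E' u a
    run-mono (d , steps , d≈a) = d , Star.map step-mono steps , Θ-mono d≈a

    reaches-mono : ∀ {c b} → Reaches E c b → Reaches E' c b
    reaches-mono (u , single , run) = u , single , run-mono run

  module NextRespects (S : TES Sg) (p q : GTm Sg) (tree : TreeAlg Sg)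
                      (valid : ValidTreeAlg Sg p q tree) (Tgt : GTm Sg → Set) where
    open Sequence Sg S p q tree Tgt

    -- Equal systems have the same automaton, hence the same trees.
    tree-resp : ∀ {E E'} → E ≐ E' →
                ∀ t → Automaton.InT Sg p q E t → tree E t ≡ tree E' t
    tree-resp (E⊆E' , E'⊆E) = tree-automaton-invariant _ _
      (λ t → mk⇔ M.inT-mono M'.inT-mono)
      (λ s t → mk⇔ M.Θ-mono M'.Θ-mono)
      where
      module M = AutomatonMonotone p q E⊆E'
      module M' = AutomatonMonotone p q E'⊆E
      tree-automaton-invariant = proj₂ (proj₂ valid)

    -- Each new equation for E is a new equation for E': conditions (1)
    -- and (2) transfer by monotonicity, (3) through E' ⊆ E, and the
    -- instantiating trees coincide by tree-resp.
    next-mono : ∀ {E E'} → E ≐ E' → next E ⊆ next E'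
    next-mono (E⊆E' , _) (inj₁ old) = inj₁ (E⊆E' old)
    next-mono {E} {E'} E≐E'@(E⊆E' , E'⊆E)
      (inj₂ ((m , l , r) , e∈S , as , a , as∈T , a∈T , runs , (x , tx , reach) ,
             not-cong , L≡ , R≡)) =
      inj₂ ((m , l , r) , e∈S , as , a , inT-mono ∘ as∈T , inT-mono a∈T ,
            Sum.map run-mono run-mono runs , (x , tx , reaches-mono reach) ,
            not-cong' , ≡.trans L≡ l-trees , ≡.trans R≡ r-trees)
      where
      open AutomatonMonotone p q E⊆E'
      same-trees : ∀ j → tree E (as j) ≡ tree E' (as j)
      same-trees j = tree-resp E≐E' (as j) (as∈T j)
      l-trees : _⟪_⟫ Sg l (tree E ∘ as) ≡ _⟪_⟫ Sg l (tree E' ∘ as)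
      l-trees = subst-ext l same-trees
      r-trees : _⟪_⟫ Sg r (tree E ∘ as) ≡ _⟪_⟫ Sg r (tree E' ∘ as)
      r-trees = subst-ext r same-trees
      not-cong' : ¬ Cong Sg E' (_⟪_⟫ Sg l (tree E' ∘ as)) (_⟪_⟫ Sg r (tree E' ∘ as))
      not-cong' c = not-cong
        (cong-mono E'⊆E (≡.subst₂ (Cong Sg E') (≡.sym l-trees) (≡.sym r-trees) c))

    next-resp : ∀ {E E'} → E ≐ E' → next E ≐ next E'
    next-resp E≐E' = next-mono E≐E' , next-mono (≐-sym E≐E')

    seq-stabilises : ∀ i → 1 ≤ i → seq i ≐ seq (suc i) → ∀ j → seq i ≐ seq (i + j)
    seq-stabilises (suc k) (s≤s z≤n) = stable-from k
      where open Iteration next next-resp (seq ∘ suc) (λ _ → ≐-refl)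

mainTheorem9 : (Sg : RankedAlphabet) (S : TES Sg) → VarPreserving Sg S →
    (p q : GTm Sg) (tree : TreeAlg Sg) → ValidTreeAlg Sg p q tree →
    (∀ i → 1 ≤ i → W Sg S p q tree i ≐ W Sg S p q tree (suc i) →
       ∀ j → W Sg S p q tree i ≐ W Sg S p q tree (i + j))
    × (∀ i → 1 ≤ i → P Sg S p q tree i ≐ P Sg S p q tree (suc i) →
       ∀ j → P Sg S p q tree i ≐ P Sg S p q tree (i + j))
    × (∀ i → 1 ≤ i → Q Sg S p q tree i ≐ Q Sg S p q tree (suc i) →
       ∀ j → Q Sg S p q tree i ≐ Q Sg S p q tree (i + j))
mainTheorem9 Sg S _ p q tree valid =
  stabilises (λ x → x ≡ p Sum.⊎ x ≡ q) ,
  stabilises (λ x → x ≡ p) ,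
  stabilises (λ x → x ≡ q)
  where
  stabilises : (Tgt : GTm Sg → Set) →
    ∀ i → 1 ≤ i → Sequence.seq Sg S p q tree Tgt i ≐ Sequence.seq Sg S p q tree Tgt (suc i) →
    ∀ j → Sequence.seq Sg S p q tree Tgt i ≐ Sequence.seq Sg S p q tree Tgt (i + j)
  stabilises Tgt = NextRespects.seq-stabilises Sg S p q tree valid Tgt
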